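{- Let $F:\mathcal{A}\to\mathcal{C}$ and $G:\mathcal{B}\to\mathcal{C}$ be functors, $\mathcal{G}=(F\downarrow G)$, $\mathcal{SG}$ the full subcategory of simple objects and $\mathcal{N}:\mathcal{SG}\to\mathcal{G}$ the inclusion. Assume $\mathcal{A}$ is regular and $F$ is faithful, preserves monomorphisms, and has a right adjoint $F^{\star}$ whose counit $\theta:FF^{\star}\to\mathrm{id}_{\mathcal{C}}$ has monomorphic components. For $(A,f,B)$ in $\mathcal{G}$ let $\hat f:A\to F^{\star}G(B)$ be the unique morphism with $\theta_{G(B)}\circ F(\hat f)=f$, let $\hat f=m_{\hat f}\circ e_{\hat f}$ be an image factorization ($e_{\hat f}:A\to\mathrm{Ran}(\hat f)$ regular epi, $m_{\hat f}$ mono), and define $\mathcal{S}(A,f,B)=(\mathrm{Ran}(\hat f),\theta_{G(B)}\circ F(m_{\hat f}),B)$ and $\eta_{(A,f,B)}=(e_{\hat f},\mathrm{id}_B)$. Then for every morphism $(\phi,\psi):(A,f,B)\to\mathcal{N}(A',f',B')$ in $\mathcal{G}$ with $(A',f',B')$ simple, there is a unique morphism $(\hat\phi,\hat\psi):\mathcal{S}(A,f,B)\to(A',f',B')$ in $\mathcal{SG}$ with $\mathcal{N}(\hat\phi,\hat\psi)\circ\eta_{(A,f,B)}=(\phi,\psi)$. Consequently $\mathcal{SG}$ is a reflective subcategory of $\mathcal{G}$.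
   Context: The comma category $(F\downarrow G)$ has objects $(A,f,B)$ with $f:F(A)\to G(B)$ in $\mathcal{C}$ and morphisms $(\phi,\psi):(A,f,B)\to(A',f',B')$ with $f'\circ F(\phi)=G(\psi)\circ f$. An object $(A,f,B)$ is simple if $f$ is a monomorphism in $\mathcal{C}$. -}

module Defs where

open import Level using (Level; _⊔_) renaming (suc to lsuc)
open import Data.Product using (Σ; _×_; _,_; proj₁; proj₂)
open import Relation.Binary using (Rel; IsEquivalence; Setoid)
import Relation.Binary.Reasoning.Setoid as SetoidR

record Category (o ℓ e : Level) : Set (lsuc (o ⊔ ℓ ⊔ e)) where
  infixr 9 _∘_
  infix  4 _≈_
  infix  4 _⇒_
  field
    Obj       : Set o
    _⇒_       : Obj → Obj → Set ℓ
    _≈_       : ∀ {A B} → Rel (A ⇒ B) e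
    id        : ∀ {A} → A ⇒ A
    _∘_       : ∀ {A B C} → B ⇒ C → A ⇒ B → A ⇒ C
    equiv     : ∀ {A B} → IsEquivalence (_≈_ {A} {B})
    assoc     : ∀ {A B C D} {f : A ⇒ B} {g : B ⇒ C} {h : C ⇒ D} →
                (h ∘ g) ∘ f ≈ h ∘ (g ∘ f)
    identityˡ : ∀ {A B} {f : A ⇒ B} → id ∘ f ≈ f
    identityʳ : ∀ {A B} {f : A ⇒ B} → f ∘ id ≈ f
    ∘-resp-≈  : ∀ {A B C} {f h : B ⇒ C} {g i : A ⇒ B} →
                f ≈ h → g ≈ i → f ∘ g ≈ h ∘ i

  hom-setoid : ∀ {A B} → Setoid ℓ e
  hom-setoid {A} {B} = record { Carrier = A ⇒ B ; _≈_ = _≈_ ; isEquivalence = equiv }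

  module Eq {A B} = IsEquivalence (equiv {A} {B})

record Functor {o ℓ e o′ ℓ′ e′ : Level}
               (C : Category o ℓ e) (D : Category o′ ℓ′ e′)
               : Set (o ⊔ ℓ ⊔ e ⊔ o′ ⊔ ℓ′ ⊔ e′) where
  private
    module C = Category C
    module D = Category D
  field
    F₀           : C.Obj → D.Obj
    F₁           : ∀ {A B} → A C.⇒ B → F₀ A D.⇒ F₀ B
    identity     : ∀ {A} → F₁ (C.id {A}) D.≈ D.id
    homomorphism : ∀ {X Y Z} {f : X C.⇒ Y} {g : Y C.⇒ Z} →
                   F₁ (g C.∘ f) D.≈ F₁ g D.∘ F₁ f
    F-resp-≈     : ∀ {A B} {f g : A C.⇒ B} → f C.≈ g → F₁ f D.≈ F₁ g

∃!≈ : ∀ {a r p} (A : Set a) → Rel A r → (A → Set p) → Set (a ⊔ r ⊔ p)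
∃!≈ A _≈_ P = Σ A (λ u → P u × (∀ v → P v → v ≈ u))

module _ {o ℓ e} (C : Category o ℓ e) where
  open Category C

  Mono : ∀ {A B} → A ⇒ B → Set (o ⊔ ℓ ⊔ e)
  Mono {A} f = ∀ {X} (g h : X ⇒ A) → f ∘ g ≈ f ∘ h → g ≈ h

  IsCoequalizer : ∀ {X A Q} → (f g : X ⇒ A) → A ⇒ Q → Set (o ⊔ ℓ ⊔ e)
  IsCoequalizer {X} {A} {Q} f g q =
    (q ∘ f ≈ q ∘ g) ×
    (∀ {Z} (h : A ⇒ Z) → h ∘ f ≈ h ∘ g → ∃!≈ (Q ⇒ Z) _≈_ (λ u → u ∘ q ≈ h))

  RegularEpi : ∀ {A Q} → A ⇒ Q → Set (o ⊔ ℓ ⊔ e)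
  RegularEpi {A} {Q} q = Σ Obj (λ X → Σ (X ⇒ A) (λ f → Σ (X ⇒ A) (λ g → IsCoequalizer f g q)))

  IsPullback : ∀ {X Y Z P} → X ⇒ Z → Y ⇒ Z → P ⇒ X → P ⇒ Y → Set (o ⊔ ℓ ⊔ e)
  IsPullback {X} {Y} {Z} {P} f g p₁ p₂ =
    (f ∘ p₁ ≈ g ∘ p₂) ×
    (∀ {W} (h₁ : W ⇒ X) (h₂ : W ⇒ Y) → f ∘ h₁ ≈ g ∘ h₂ →
       ∃!≈ (W ⇒ P) _≈_ (λ u → (p₁ ∘ u ≈ h₁) × (p₂ ∘ u ≈ h₂)))

  IsTerminal : Obj → Set (o ⊔ ℓ ⊔ e)
  IsTerminal T = ∀ X → ∃!≈ (X ⇒ T) _≈_ (λ _ → Level.Lift e Data.Unit.⊤)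
    where import Data.Unit

  record Regular : Set (o ⊔ ℓ ⊔ e) where
    field
      terminal        : Σ Obj IsTerminal
      pullback        : ∀ {X Y Z} (f : X ⇒ Z) (g : Y ⇒ Z) →
                        Σ Obj (λ P → Σ (P ⇒ X) (λ p₁ → Σ (P ⇒ Y) (λ p₂ → IsPullback f g p₁ p₂)))
      kernel-coeq     : ∀ {X Y K} (f : X ⇒ Y) (p₁ p₂ : K ⇒ X) → IsPullback f f p₁ p₂ →
                        Σ Obj (λ Q → Σ (X ⇒ Q) (λ q → IsCoequalizer p₁ p₂ q))
      pullback-stable : ∀ {X Y Z P} (q : X ⇒ Z) (g : Y ⇒ Z) (p₁ : P ⇒ X) (p₂ : P ⇒ Y) →
                        IsPullback q g p₁ p₂ → RegularEpi q → RegularEpi p₂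

module _ {o ℓ e o′ ℓ′ e′} {C : Category o ℓ e} {D : Category o′ ℓ′ e′} where
  private
    module C = Category C
    module D = Category D

  Faithful : Functor C D → Set (o ⊔ ℓ ⊔ e ⊔ e′)
  Faithful F = ∀ {A B} (f g : A C.⇒ B) → F₁ f D.≈ F₁ g → f C.≈ g
    where open Functor F

  PreservesMonos : Functor C D → Set (o ⊔ ℓ ⊔ e ⊔ o′ ⊔ ℓ′ ⊔ e′)
  PreservesMonos F = ∀ {A B} (f : A C.⇒ B) → Mono C f → Mono D (F₁ f)
    where open Functor F

  -- F has a right adjoint F⋆ with counit θ : F F⋆ → id, presented by the
  -- universal property of the counit: every f : F A → X factors uniquely
  -- as θ_X ∘ F(f̂).
  record RightAdjoint (F : Functor C D) : Set (o ⊔ ℓ ⊔ e ⊔ o′ ⊔ ℓ′ ⊔ e′) where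
    open Functor F
    field
      R            : Functor D C
    open Functor R renaming (F₀ to R₀; F₁ to R₁) public
    field
      counit       : ∀ X → F₀ (R₀ X) D.⇒ X
      counit-nat   : ∀ {X Y} (h : X D.⇒ Y) → counit Y D.∘ F₁ (R₁ h) D.≈ h D.∘ counit X
      universal    : ∀ {A X} (f : F₀ A D.⇒ X) →
                     ∃!≈ (A C.⇒ R₀ X) C._≈_ (λ g → counit X D.∘ F₁ g D.≈ f)

module _ {oa la ea ob lb eb oc lc ec}
         {𝒜 : Category oa la ea} {ℬ : Category ob lb eb} {𝒞 : Category oc lc ec}
         (F : Functor 𝒜 𝒞) (G : Functor ℬ 𝒞) where
  private
    module 𝒜 = Category 𝒜
    module ℬ = Category ℬ
    module 𝒞 = Category 𝒞
    module F = Functor F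
    module G = Functor G

  record CommaObj : Set (oa ⊔ ob ⊔ lc) where
    constructor commaObj
    field
      dom : 𝒜.Obj
      cod : ℬ.Obj
      arr : F.F₀ dom 𝒞.⇒ G.F₀ cod
  open CommaObj public

  record CommaHom (X Y : CommaObj) : Set (la ⊔ lb ⊔ ec) where
    constructor commaHom
    field
      φ       : dom X 𝒜.⇒ dom Y
      ψ       : cod X ℬ.⇒ cod Y
      commute : arr Y 𝒞.∘ F.F₁ φ 𝒞.≈ G.F₁ ψ 𝒞.∘ arr X
  open CommaHom public

  infix 4 _≈ᶜ_
  _≈ᶜ_ : ∀ {X Y} → Rel (CommaHom X Y) (ea ⊔ eb)
  h ≈ᶜ k = (φ h 𝒜.≈ φ k) × (ψ h ℬ.≈ ψ k)

  infixr 9 _∘ᶜ_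
  _∘ᶜ_ : ∀ {X Y Z} → CommaHom Y Z → CommaHom X Y → CommaHom X Z
  _∘ᶜ_ {X} {Y} {Z} k h = commaHom (φ k 𝒜.∘ φ h) (ψ k ℬ.∘ ψ h) pf
    where
    open SetoidR 𝒞.hom-setoid
    open 𝒞 using (_∘_; assoc; ∘-resp-≈)
    pf = begin
      arr Z ∘ F.F₁ (φ k 𝒜.∘ φ h)          ≈⟨ ∘-resp-≈ 𝒞.Eq.refl F.homomorphism ⟩
      arr Z ∘ (F.F₁ (φ k) ∘ F.F₁ (φ h))   ≈⟨ 𝒞.Eq.sym assoc ⟩
      (arr Z ∘ F.F₁ (φ k)) ∘ F.F₁ (φ h)   ≈⟨ ∘-resp-≈ (commute k) 𝒞.Eq.refl ⟩
      (G.F₁ (ψ k) ∘ arr Y) ∘ F.F₁ (φ h)   ≈⟨ assoc ⟩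
      G.F₁ (ψ k) ∘ (arr Y ∘ F.F₁ (φ h))   ≈⟨ ∘-resp-≈ 𝒞.Eq.refl (commute h) ⟩
      G.F₁ (ψ k) ∘ (G.F₁ (ψ h) ∘ arr X)   ≈⟨ 𝒞.Eq.sym assoc ⟩
      (G.F₁ (ψ k) ∘ G.F₁ (ψ h)) ∘ arr X   ≈⟨ ∘-resp-≈ (𝒞.Eq.sym G.homomorphism) 𝒞.Eq.refl ⟩
      G.F₁ (ψ k ℬ.∘ ψ h) ∘ arr X          ∎

  -- The full subcategory 𝒮𝒢 has these objects and all comma morphisms
  -- between them; 𝒩 : 𝒮𝒢 → 𝒢 is the identity on objects and morphisms.
  Simple : CommaObj → Set (oc ⊔ lc ⊔ ec)
  Simple X = Mono 𝒞 (arr X)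

  IsReflection : (X S : CommaObj) → CommaHom X S →
                 Set (oa ⊔ la ⊔ ea ⊔ ob ⊔ lb ⊔ eb ⊔ oc ⊔ lc ⊔ ec)
  IsReflection X S η =
    ∀ (Y : CommaObj) → Simple Y → (h : CommaHom X Y) →
      ∃!≈ (CommaHom S Y) _≈ᶜ_ (λ k → (k ∘ᶜ η) ≈ᶜ h)

  SimpleReflective : Set (oa ⊔ la ⊔ ea ⊔ ob ⊔ lb ⊔ eb ⊔ oc ⊔ lc ⊔ ec)
  SimpleReflective =
    ∀ (X : CommaObj) → Σ CommaObj (λ S → Simple S × Σ (CommaHom X S) (λ η → IsReflection X S η))

module _ {oa la ea ob lb eb oc lc ec}
         {𝒜 : Category oa la ea} {ℬ : Category ob lb eb} {𝒞 : Category oc lc ec}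
         {F : Functor 𝒜 𝒞} {G : Functor ℬ 𝒞} (adj : RightAdjoint F) where
  private
    module 𝒜 = Category 𝒜
    module ℬ = Category ℬ
    module 𝒞 = Category 𝒞
    module F = Functor F
    module G = Functor G
    open RightAdjoint adj using (R₀; counit)

  SObj : (X : CommaObj F G) {Ran : 𝒜.Obj} (m : Ran 𝒜.⇒ R₀ (G.F₀ (cod X))) → CommaObj F G
  SObj X {Ran} m = commaObj Ran (cod X) (counit (G.F₀ (cod X)) 𝒞.∘ F.F₁ m)

  etaHom : (X : CommaObj F G) {Ran : 𝒜.Obj}
           (fhat : dom X 𝒜.⇒ R₀ (G.F₀ (cod X))) →
           counit (G.F₀ (cod X)) 𝒞.∘ F.F₁ fhat 𝒞.≈ arr X →
           (e : dom X 𝒜.⇒ Ran) (m : Ran 𝒜.⇒ R₀ (G.F₀ (cod X))) →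
           m 𝒜.∘ e 𝒜.≈ fhat →
           CommaHom F G X (SObj X m)
  etaHom X fhat hatEq e m fact = commaHom e ℬ.id pf
    where
    open SetoidR 𝒞.hom-setoid
    open 𝒞 using (_∘_; assoc; ∘-resp-≈)
    θ = counit (G.F₀ (cod X))
    pf = begin
      (θ ∘ F.F₁ m) ∘ F.F₁ e     ≈⟨ assoc ⟩
      θ ∘ (F.F₁ m ∘ F.F₁ e)     ≈⟨ ∘-resp-≈ 𝒞.Eq.refl (𝒞.Eq.sym F.homomorphism) ⟩
      θ ∘ F.F₁ (m 𝒜.∘ e)        ≈⟨ ∘-resp-≈ 𝒞.Eq.refl (F.F-resp-≈ fact) ⟩
      θ ∘ F.F₁ fhat             ≈⟨ hatEq ⟩
      arr X                 ≈⟨ 𝒞.Eq.sym 𝒞.identityˡ ⟩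
      𝒞.id ∘ arr X          ≈⟨ ∘-resp-≈ (𝒞.Eq.sym G.identity) 𝒞.Eq.refl ⟩
      G.F₁ ℬ.id ∘ arr X     ∎

-- A morphism (φ , ψ) from (A , f , B) to a simple (A' , f' , B') factors through
-- η = (e , id) as soon as φ factors through e.  Since e coequalizes some pair,
-- it suffices that φ coequalizes it too; this holds because f' ∘ F φ = G ψ ∘ f
-- factors through F e, f' is monic and F is faithful.  The comma square of the
-- factorization then commutes because F e is epi, F being a left adjoint.
-- 𝒮(A , f , B) is simple as θ ∘ F m is a composite of monos, and the
-- factorization of f̂ exists because 𝒜 is regular: coequalize its kernel pair.

module Submission where

open import Level using (_⊔_)
open import Data.Product using (Σ; _×_; _,_; proj₁; proj₂)
import Relation.Binary.Reasoning.Setoid as SetoidR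

open import Defs

module HomReasoning {o ℓ e} (C : Category o ℓ e) where
  open Category C

  module _ {A B : Obj} where
    open SetoidR (hom-setoid {A} {B}) public

  infixr 4 _⟩∘⟨_ refl⟩∘⟨_
  infixl 5 _⟩∘⟨refl

  _⟩∘⟨_ : ∀ {A B D} {f h : B ⇒ D} {g i : A ⇒ B} → f ≈ h → g ≈ i → f ∘ g ≈ h ∘ i
  _⟩∘⟨_ = ∘-resp-≈

  refl⟩∘⟨_ : ∀ {A B D} {f : B ⇒ D} {g i : A ⇒ B} → g ≈ i → f ∘ g ≈ f ∘ i
  refl⟩∘⟨ p = Eq.refl ⟩∘⟨ p

  _⟩∘⟨refl : ∀ {A B D} {f h : B ⇒ D} {g : A ⇒ B} → f ≈ h → f ∘ g ≈ h ∘ g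
  p ⟩∘⟨refl = p ⟩∘⟨ Eq.refl

module _ {o ℓ e} (C : Category o ℓ e) where
  open Category C
  open HomReasoning C

  Epi : ∀ {A B} → A ⇒ B → Set (o ⊔ ℓ ⊔ e)
  Epi {B = B} f = ∀ {X} (g h : B ⇒ X) → g ∘ f ≈ h ∘ f → g ≈ h

  Mono-∘ : ∀ {A B D} {f : B ⇒ D} {g : A ⇒ B} → Mono C f → Mono C g → Mono C (f ∘ g)
  Mono-∘ {f = f} {g} f-mono g-mono a b fga≈fgb = g-mono a b (f-mono (g ∘ a) (g ∘ b) (begin
    f ∘ (g ∘ a)  ≈⟨ Eq.sym assoc ⟩
    (f ∘ g) ∘ a  ≈⟨ fga≈fgb ⟩
    (f ∘ g) ∘ b  ≈⟨ assoc ⟩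
    f ∘ (g ∘ b)  ∎))

  Epi-∘ : ∀ {A B D} {f : B ⇒ D} {g : A ⇒ B} → Epi f → Epi g → Epi (f ∘ g)
  Epi-∘ {f = f} {g} f-epi g-epi a b afg≈bfg = f-epi a b (g-epi (a ∘ f) (b ∘ f) (begin
    (a ∘ f) ∘ g  ≈⟨ assoc ⟩
    a ∘ (f ∘ g)  ≈⟨ afg≈bfg ⟩
    b ∘ (f ∘ g)  ≈⟨ Eq.sym assoc ⟩
    (b ∘ f) ∘ g  ∎))

  RegularEpi⇒Epi : ∀ {A Q} {q : A ⇒ Q} → RegularEpi C q → Epi q
  RegularEpi⇒Epi {Q = Q} {q} (_ , f , g , q∘f≈q∘g , universal) {X} a b aq≈bq =
    Eq.trans (unique a Eq.refl) (Eq.sym (unique b (Eq.sym aq≈bq)))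
    where
    aq-coequalizes : (a ∘ q) ∘ f ≈ (a ∘ q) ∘ g
    aq-coequalizes = begin
      (a ∘ q) ∘ f  ≈⟨ assoc ⟩
      a ∘ (q ∘ f)  ≈⟨ refl⟩∘⟨ q∘f≈q∘g ⟩
      a ∘ (q ∘ g)  ≈⟨ Eq.sym assoc ⟩
      (a ∘ q) ∘ g  ∎
    unique : ∀ (v : Q ⇒ X) → v ∘ q ≈ a ∘ q → v ≈ proj₁ (universal (a ∘ q) aq-coequalizes)
    unique = proj₂ (proj₂ (universal (a ∘ q) aq-coequalizes))

  record CoveringLift {A Q W} (q : A ⇒ Q) (x : W ⇒ Q) : Set (o ⊔ ℓ ⊔ e) where
    field
      {Cover}       : Obj
      cover         : Cover ⇒ W
      cover-regular : RegularEpi C cover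
      lift          : Cover ⇒ A
      commute       : q ∘ lift ≈ x ∘ cover

  record ImageFactorization {A B} (f : A ⇒ B) : Set (o ⊔ ℓ ⊔ e) where
    field
      {Image}       : Obj
      cover         : A ⇒ Image
      image         : Image ⇒ B
      cover-regular : RegularEpi C cover
      image-mono    : Mono C image
      factors       : image ∘ cover ≈ f

  module _ (regular : Regular C) where
    open Regular regular

    covering-lift : ∀ {A Q W} {q : A ⇒ Q} → RegularEpi C q → (x : W ⇒ Q) → CoveringLift q x
    covering-lift {q = q} q-regular x
      with _ , lift , cover , isPullback ← pullback q x = record
      { cover         = cover
      ; cover-regular = pullback-stable q x lift cover isPullback q-regular
      ; lift          = lift
      ; commute       = proj₁ isPullback
      }

    -- Two maps into Q agreeing after m are lifted along q, on a common epi
    -- cover, to a pair identified by f, hence factoring through the kernel pair.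
    kernelPair-quotient-mono : ∀ {A B K Q} {f : A ⇒ B} {p₁ p₂ : K ⇒ A} {q : A ⇒ Q} {m : Q ⇒ B} →
                               IsPullback C f f p₁ p₂ → IsCoequalizer C p₁ p₂ q →
                               m ∘ q ≈ f → Mono C m
    kernelPair-quotient-mono {A} {K = K} {f = f} {p₁} {p₂} {q} {m} (_ , kernel) coeq@(q∘p₁≈q∘p₂ , _) mq≈f
                             {W} x y mx≈my =
      Epi-∘ (RegularEpi⇒Epi (cover-regular x-lift)) (RegularEpi⇒Epi (cover-regular y-lift)) x y xc≈yc
      where
      open CoveringLift
      q-regular : RegularEpi C q
      q-regular = _ , p₁ , p₂ , coeq
      x-lift : CoveringLift q x
      x-lift = covering-lift q-regular x
      y-lift : CoveringLift q (y ∘ cover x-lift)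
      y-lift = covering-lift q-regular (y ∘ cover x-lift)
      c : Cover y-lift ⇒ W
      c = cover x-lift ∘ cover y-lift
      a₁ a₂ : Cover y-lift ⇒ A
      a₁ = lift x-lift ∘ cover y-lift
      a₂ = lift y-lift

      qa₁≈xc : q ∘ a₁ ≈ x ∘ c
      qa₁≈xc = begin
        q ∘ (lift x-lift ∘ cover y-lift)   ≈⟨ Eq.sym assoc ⟩
        (q ∘ lift x-lift) ∘ cover y-lift   ≈⟨ commute x-lift ⟩∘⟨refl ⟩
        (x ∘ cover x-lift) ∘ cover y-lift  ≈⟨ assoc ⟩
        x ∘ c                              ∎

      qa₂≈yc : q ∘ a₂ ≈ y ∘ c
      qa₂≈yc = Eq.trans (commute y-lift) assoc

      fa₁≈fa₂ : f ∘ a₁ ≈ f ∘ a₂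
      fa₁≈fa₂ = begin
        f ∘ a₁        ≈⟨ Eq.sym mq≈f ⟩∘⟨refl ⟩
        (m ∘ q) ∘ a₁  ≈⟨ assoc ⟩
        m ∘ (q ∘ a₁)  ≈⟨ refl⟩∘⟨ qa₁≈xc ⟩
        m ∘ (x ∘ c)   ≈⟨ Eq.sym assoc ⟩
        (m ∘ x) ∘ c   ≈⟨ mx≈my ⟩∘⟨refl ⟩
        (m ∘ y) ∘ c   ≈⟨ assoc ⟩
        m ∘ (y ∘ c)   ≈⟨ refl⟩∘⟨ Eq.sym qa₂≈yc ⟩
        m ∘ (q ∘ a₂)  ≈⟨ Eq.sym assoc ⟩
        (m ∘ q) ∘ a₂  ≈⟨ mq≈f ⟩∘⟨refl ⟩
        f ∘ a₂        ∎

      u : Cover y-lift ⇒ K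
      u = proj₁ (kernel a₁ a₂ fa₁≈fa₂)
      p₁u : p₁ ∘ u ≈ a₁
      p₁u = proj₁ (proj₁ (proj₂ (kernel a₁ a₂ fa₁≈fa₂)))
      p₂u : p₂ ∘ u ≈ a₂
      p₂u = proj₂ (proj₁ (proj₂ (kernel a₁ a₂ fa₁≈fa₂)))

      xc≈yc : x ∘ c ≈ y ∘ c
      xc≈yc = begin
        x ∘ c           ≈⟨ Eq.sym qa₁≈xc ⟩
        q ∘ a₁          ≈⟨ refl⟩∘⟨ Eq.sym p₁u ⟩
        q ∘ (p₁ ∘ u)    ≈⟨ Eq.sym assoc ⟩
        (q ∘ p₁) ∘ u    ≈⟨ q∘p₁≈q∘p₂ ⟩∘⟨refl ⟩
        (q ∘ p₂) ∘ u    ≈⟨ assoc ⟩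
        q ∘ (p₂ ∘ u)    ≈⟨ refl⟩∘⟨ p₂u ⟩
        q ∘ a₂          ≈⟨ qa₂≈yc ⟩
        y ∘ c           ∎

    image-factorization : ∀ {A B} (f : A ⇒ B) → ImageFactorization f
    image-factorization f
      with _ , p₁ , p₂ , kernel ← pullback f f
      with _ , q , coeq ← kernel-coeq f p₁ p₂ kernel
      with m , mq≈f , _ ← proj₂ coeq f (proj₁ kernel) = record
      { cover         = q
      ; image         = m
      ; cover-regular = _ , p₁ , p₂ , coeq
      ; image-mono    = kernelPair-quotient-mono kernel coeq mq≈f
      ; factors       = mq≈f
      }

module _ {o ℓ e o′ ℓ′ e′} {𝒜 : Category o ℓ e} {𝒞 : Category o′ ℓ′ e′} (F : Functor 𝒜 𝒞) where
  private
    module 𝒜 = Category 𝒜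
  open Category 𝒞
  open Functor F
  open HomReasoning 𝒞

  leftAdjoint-preserves-Epi : RightAdjoint F → ∀ {A Q} {q : A 𝒜.⇒ Q} → Epi 𝒜 q → Epi 𝒞 (F₁ q)
  leftAdjoint-preserves-Epi adj {A} {Q} {q} q-epi {W} u v uFq≈vFq = begin
    u                  ≈⟨ Eq.sym θû≈u ⟩
    counit W ∘ F₁ û    ≈⟨ refl⟩∘⟨ F-resp-≈ û≈v̂ ⟩
    counit W ∘ F₁ v̂    ≈⟨ θv̂≈v ⟩
    v                  ∎
    where
    open RightAdjoint adj using (R₀; counit; universal)
    û v̂ : Q 𝒜.⇒ R₀ W
    û = proj₁ (universal u)
    v̂ = proj₁ (universal v)
    θû≈u : counit W ∘ F₁ û ≈ u
    θû≈u = proj₁ (proj₂ (universal u))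
    θv̂≈v : counit W ∘ F₁ v̂ ≈ v
    θv̂≈v = proj₁ (proj₂ (universal v))

    transposes : ∀ {t : Q 𝒜.⇒ R₀ W} {k : F₀ Q ⇒ W} →
                 counit W ∘ F₁ t ≈ k → counit W ∘ F₁ (t 𝒜.∘ q) ≈ k ∘ F₁ q
    transposes {t} {k} θt≈k = begin
      counit W ∘ F₁ (t 𝒜.∘ q)      ≈⟨ refl⟩∘⟨ homomorphism ⟩
      counit W ∘ (F₁ t ∘ F₁ q)     ≈⟨ Eq.sym assoc ⟩
      (counit W ∘ F₁ t) ∘ F₁ q     ≈⟨ θt≈k ⟩∘⟨refl ⟩
      k ∘ F₁ q                     ∎

    unique : ∀ (t : A 𝒜.⇒ R₀ W) → counit W ∘ F₁ t ≈ u ∘ F₁ q → t 𝒜.≈ proj₁ (universal (u ∘ F₁ q))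
    unique = proj₂ (proj₂ (universal (u ∘ F₁ q)))
    û≈v̂ : û 𝒜.≈ v̂
    û≈v̂ = q-epi û v̂ (𝒜.Eq.trans (unique _ (transposes θû≈u))
                                  (𝒜.Eq.sym (unique _ (Eq.trans (transposes θv̂≈v) (Eq.sym uFq≈vFq)))))

  regularEpi-diagonal : Faithful F →
                        ∀ {A Q B Z} {e : A 𝒜.⇒ Q} {n : F₀ B ⇒ Z} {u : A 𝒜.⇒ B} {v : F₀ Q ⇒ Z} →
                        RegularEpi 𝒜 e → Epi 𝒞 (F₁ e) → Mono 𝒞 n →
                        n ∘ F₁ u ≈ v ∘ F₁ e →
                        Σ (Q 𝒜.⇒ B) (λ d → (d 𝒜.∘ e 𝒜.≈ u) × (n ∘ F₁ d ≈ v))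
  regularEpi-diagonal faithful {A} {Q} {B} {e = e} {n} {u} {v} (_ , f , g , ef≈eg , universal) Fe-epi n-mono square =
    d , de≈u , Fe-epi (n ∘ F₁ d) v (begin
      (n ∘ F₁ d) ∘ F₁ e  ≈⟨ assoc ⟩
      n ∘ (F₁ d ∘ F₁ e)  ≈⟨ refl⟩∘⟨ Eq.sym homomorphism ⟩
      n ∘ F₁ (d 𝒜.∘ e)   ≈⟨ refl⟩∘⟨ F-resp-≈ de≈u ⟩
      n ∘ F₁ u           ≈⟨ square ⟩
      v ∘ F₁ e           ∎)
    where
    square-after : ∀ {W} (k : W 𝒜.⇒ A) → n ∘ F₁ (u 𝒜.∘ k) ≈ v ∘ F₁ (e 𝒜.∘ k)
    square-after k = begin
      n ∘ F₁ (u 𝒜.∘ k)     ≈⟨ refl⟩∘⟨ homomorphism ⟩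
      n ∘ (F₁ u ∘ F₁ k)    ≈⟨ Eq.sym assoc ⟩
      (n ∘ F₁ u) ∘ F₁ k    ≈⟨ square ⟩∘⟨refl ⟩
      (v ∘ F₁ e) ∘ F₁ k    ≈⟨ assoc ⟩
      v ∘ (F₁ e ∘ F₁ k)    ≈⟨ refl⟩∘⟨ Eq.sym homomorphism ⟩
      v ∘ F₁ (e 𝒜.∘ k)     ∎

    u-coequalizes : u 𝒜.∘ f 𝒜.≈ u 𝒜.∘ g
    u-coequalizes = faithful _ _ (n-mono _ _ (begin
      n ∘ F₁ (u 𝒜.∘ f)  ≈⟨ square-after f ⟩
      v ∘ F₁ (e 𝒜.∘ f)  ≈⟨ refl⟩∘⟨ F-resp-≈ ef≈eg ⟩
      v ∘ F₁ (e 𝒜.∘ g)  ≈⟨ Eq.sym (square-after g) ⟩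
      n ∘ F₁ (u 𝒜.∘ g)  ∎))

    d : Q 𝒜.⇒ B
    d = proj₁ (universal u u-coequalizes)
    de≈u : d 𝒜.∘ e 𝒜.≈ u
    de≈u = proj₁ (proj₂ (universal u u-coequalizes))

module _ {oa la ea ob lb eb oc lc ec}
         {𝒜 : Category oa la ea} {ℬ : Category ob lb eb} {𝒞 : Category oc lc ec}
         {F : Functor 𝒜 𝒞} {G : Functor ℬ 𝒞} (adj : RightAdjoint F) where
  private
    module 𝒜 = Category 𝒜
    module ℬ = Category ℬ
    module G = Functor G
  open Category 𝒞
  open Functor F
  open HomReasoning 𝒞
  open RightAdjoint adj using (R₀; counit; universal)

  SObj-simple : (∀ Z → Mono 𝒞 (counit Z)) → PreservesMonos F →
                ∀ (X : CommaObj F G) {Ran} {m : Ran 𝒜.⇒ R₀ (G.F₀ (cod X))} →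
                Mono 𝒜 m → Simple F G (SObj adj X m)
  SObj-simple θ-mono F-mono X {m = m} m-mono = Mono-∘ 𝒞 (θ-mono _) (F-mono m m-mono)

  etaHom-isReflection : Faithful F →
                        ∀ (X : CommaObj F G) (fhat : dom X 𝒜.⇒ R₀ (G.F₀ (cod X)))
                          (hatEq : counit (G.F₀ (cod X)) ∘ F₁ fhat ≈ arr X)
                          {Ran} (e : dom X 𝒜.⇒ Ran) (m : Ran 𝒜.⇒ R₀ (G.F₀ (cod X))) →
                        RegularEpi 𝒜 e → (fact : m 𝒜.∘ e 𝒜.≈ fhat) →
                        IsReflection F G X (SObj adj X m) (etaHom adj X fhat hatEq e m fact)
  etaHom-isReflection faithful X fhat hatEq {Ran} e m e-regular fact Y Y-simple (commaHom φ′ ψ′ h-commute) =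
    commaHom d ψ′ d-commute , (de≈φ′ , ℬ.identityʳ) , unique
    where
    θ : F₀ (R₀ (G.F₀ (cod X))) ⇒ G.F₀ (cod X)
    θ = counit (G.F₀ (cod X))
    e-epi : Epi 𝒜 e
    e-epi = RegularEpi⇒Epi 𝒜 e-regular
    Fe-epi : Epi 𝒞 (F₁ e)
    Fe-epi = leftAdjoint-preserves-Epi F adj e-epi

    square : arr Y ∘ F₁ φ′ ≈ (G.F₁ ψ′ ∘ (θ ∘ F₁ m)) ∘ F₁ e
    square = begin
      arr Y ∘ F₁ φ′                    ≈⟨ h-commute ⟩
      G.F₁ ψ′ ∘ arr X                  ≈⟨ refl⟩∘⟨ Eq.sym hatEq ⟩
      G.F₁ ψ′ ∘ (θ ∘ F₁ fhat)          ≈⟨ refl⟩∘⟨ refl⟩∘⟨ F-resp-≈ (𝒜.Eq.sym fact) ⟩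
      G.F₁ ψ′ ∘ (θ ∘ F₁ (m 𝒜.∘ e))     ≈⟨ refl⟩∘⟨ refl⟩∘⟨ homomorphism ⟩
      G.F₁ ψ′ ∘ (θ ∘ (F₁ m ∘ F₁ e))    ≈⟨ refl⟩∘⟨ Eq.sym assoc ⟩
      G.F₁ ψ′ ∘ ((θ ∘ F₁ m) ∘ F₁ e)    ≈⟨ Eq.sym assoc ⟩
      (G.F₁ ψ′ ∘ (θ ∘ F₁ m)) ∘ F₁ e    ∎

    diagonal : Σ (Ran 𝒜.⇒ dom Y) (λ d → (d 𝒜.∘ e 𝒜.≈ φ′) × (arr Y ∘ F₁ d ≈ G.F₁ ψ′ ∘ (θ ∘ F₁ m)))
    diagonal = regularEpi-diagonal F faithful e-regular Fe-epi Y-simple square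
    d : Ran 𝒜.⇒ dom Y
    d = proj₁ diagonal
    de≈φ′ : d 𝒜.∘ e 𝒜.≈ φ′
    de≈φ′ = proj₁ (proj₂ diagonal)
    d-commute : arr Y ∘ F₁ d ≈ G.F₁ ψ′ ∘ (θ ∘ F₁ m)
    d-commute = proj₂ (proj₂ diagonal)

    unique : ∀ (k : CommaHom F G (SObj adj X m) Y) →
             (φ k 𝒜.∘ e 𝒜.≈ φ′) × (ψ k ℬ.∘ ℬ.id ℬ.≈ ψ′) → (φ k 𝒜.≈ d) × (ψ k ℬ.≈ ψ′)
    unique k (kφe≈φ′ , kψ≈ψ′) =
      e-epi (φ k) d (𝒜.Eq.trans kφe≈φ′ (𝒜.Eq.sym de≈φ′)) ,
      ℬ.Eq.trans (ℬ.Eq.sym ℬ.identityʳ) kψ≈ψ′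

  simpleReflective : Regular 𝒜 → Faithful F → PreservesMonos F → (∀ Z → Mono 𝒞 (counit Z)) →
                     SimpleReflective F G
  simpleReflective regular faithful F-mono θ-mono X =
    SObj adj X image ,
    SObj-simple θ-mono F-mono X image-mono ,
    etaHom adj X fhat hatEq cover image factors ,
    etaHom-isReflection faithful X fhat hatEq cover image cover-regular factors
    where
    fhat : dom X 𝒜.⇒ R₀ (G.F₀ (cod X))
    fhat = proj₁ (universal (arr X))
    hatEq : counit (G.F₀ (cod X)) ∘ F₁ fhat ≈ arr X
    hatEq = proj₁ (proj₂ (universal (arr X)))
    open ImageFactorization (image-factorization 𝒜 regular fhat)

mainTheorem6 : ∀ {oa la ea ob lb eb oc lc ec}
                 {𝒜 : Category oa la ea} {ℬ : Category ob lb eb} {𝒞 : Category oc lc ec}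
                 (F : Functor 𝒜 𝒞) (G : Functor ℬ 𝒞) →
                 Regular 𝒜 →
                 Faithful F →
                 PreservesMonos F →
                 (adj : RightAdjoint F) →
                 (∀ X → Mono 𝒞 (RightAdjoint.counit adj X)) →
                 (∀ (X : CommaObj F G)
                    (fhat : Category._⇒_ 𝒜 (CommaObj.dom X)
                              (RightAdjoint.R₀ adj (Functor.F₀ G (CommaObj.cod X))))
                    (hatEq : Category._≈_ 𝒞
                               (Category._∘_ 𝒞 (RightAdjoint.counit adj (Functor.F₀ G (CommaObj.cod X)))
                                  (Functor.F₁ F fhat))
                               (CommaObj.arr X))
                    {Ran : Category.Obj 𝒜}
                    (e : Category._⇒_ 𝒜 (CommaObj.dom X) Ran)
                    (m : Category._⇒_ 𝒜 Ran (RightAdjoint.R₀ adj (Functor.F₀ G (CommaObj.cod X)))) →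
                    RegularEpi 𝒜 e →
                    Mono 𝒜 m →
                    (fact : Category._≈_ 𝒜 (Category._∘_ 𝒜 m e) fhat) →
                    Simple F G (SObj adj X m) × IsReflection F G X (SObj adj X m) (etaHom adj X fhat hatEq e m fact))
                 × SimpleReflective F G
mainTheorem6 F G regular faithful F-mono adj θ-mono =
  (λ X fhat hatEq e m e-regular m-mono fact →
     SObj-simple adj θ-mono F-mono X m-mono ,
     etaHom-isReflection adj faithful X fhat hatEq e m e-regular fact) ,
  simpleReflective adj regular faithful F-mono θ-mono
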